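{- Any randomised online algorithm for the online swap matching problem requires $\Omega(m)$ bits of space. This holds already when pattern and text are over the binary alphabet $\{0,1\}$.
   Context: A swap at position $i$ of a string $S$ exchanges the characters $S[i]$ and $S[i+1]$. A string $P$ of length $m$ swap-matches a string $W$ of length $m$ if $P$ can be transformed into $W$ by applying a set of swaps in which each position is involved in at most one swap. The online swap matching problem: after each text character arrives (once at least $m$ have arrived), report whether the pattern $P$ swap-matches the last $m$ characters of the text. Online model: $P$ is given first and may be preprocessed arbitrarily; afterwards it is available only through the algorithm's memory. The text then arrives one character at a time. Algorithms are randomised with private randomness, and each output must be correct with probability at least $2/3$. Space is the number of bits of internal state kept after preprocessing. A bound of $\Omega(m)$ bits means that for every $m$ some pattern of length $m$ forces $\Omega(m)$ bits.
   Formalization: The randomised online algorithms range only over those whose initial-state and transition probabilities, including the probabilities of each output bit, are rational. -}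

module Defs where

open import Data.Bool using (Bool; true; false)
open import Data.Nat using (ℕ; zero; suc; _<_; _≤_; _∸_; _^_)
open import Data.Fin using (Fin; zero; suc)
open import Data.List using (List; []; _∷_; foldr; length; drop; _++_; [_])
open import Data.List.Relation.Unary.All using (All)
open import Data.List.Relation.Unary.AllPairs using (AllPairs)
open import Data.Product using (Σ; _×_; ∃)
open import Data.Sum using (_⊎_)
open import Data.Integer using (+_)
open import Data.Rational using (ℚ; 0ℚ; 1ℚ; _+_; _*_; _/_) renaming (_≤_ to _≤ℚ_)
open import Relation.Binary.PropositionalEquality using (_≡_)
open import Relation.Nullary using (¬_)

applySwap : {A : Set} → ℕ → List A → List A
applySwap zero    (a ∷ b ∷ xs) = b ∷ a ∷ xs
applySwap zero    xs           = xs
applySwap (suc i) []           = []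
applySwap (suc i) (x ∷ xs)     = x ∷ applySwap i xs

DisjointSwaps : ℕ → ℕ → Set
DisjointSwaps i j = (suc i < j) ⊎ (suc j < i)

SwapMatches : {A : Set} → List A → List A → Set
SwapMatches P W =
  Σ (List ℕ) λ I →
    All (λ i → suc i < length P) I ×
    AllPairs DisjointSwaps I ×
    foldr applySwap P I ≡ W

sumFin : {k : ℕ} → (Fin k → ℚ) → ℚ
sumFin {zero}  f = 0ℚ
sumFin {suc k} f = f zero + sumFin (λ i → f (suc i))

sumBool : (Bool → ℚ) → ℚ
sumBool f = f false + f true

-- Randomised online algorithms over the binary alphabet using s bits of
-- state (state space Fin (2 ^ s)). Randomness is private and may be used
-- at every step: the algorithm starts in a random state and, on reading a
-- character, moves to a random new state and emits a random output bit.

record OnlineAlg (s : ℕ) : Set where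
  field
    init      : Fin (2 ^ s) → ℚ
    step      : Fin (2 ^ s) → Bool → Fin (2 ^ s) → Bool → ℚ
    init-nonneg : ∀ q → 0ℚ ≤ℚ init q
    init-sum    : sumFin init ≡ 1ℚ
    step-nonneg : ∀ q c q' b → 0ℚ ≤ℚ step q c q' b
    step-sum    : ∀ q c → sumFin (λ q' → sumBool (λ b → step q c q' b)) ≡ 1ℚ

module _ {s : ℕ} (A : OnlineAlg s) where
  open OnlineAlg A

  nextDist : (Fin (2 ^ s) → ℚ) → Bool → (Fin (2 ^ s) → ℚ)
  nextDist d c q' = sumFin (λ q → d q * sumBool (λ b → step q c q' b))

  runFrom : (Fin (2 ^ s) → ℚ) → List Bool → (Fin (2 ^ s) → ℚ)
  runFrom d []       = d
  runFrom d (c ∷ cs) = runFrom (nextDist d c) cs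

  stateDist : List Bool → (Fin (2 ^ s) → ℚ)
  stateDist t = runFrom init t

  outProb : List Bool → Bool → Bool → ℚ
  outProb t c b =
    sumFin (λ q → stateDist t q * sumFin (λ q' → step q c q' b))

lastChars : {A : Set} → ℕ → List A → List A
lastChars m u = drop (length u ∸ m) u

twoThirds : ℚ
twoThirds = + 2 / 3

SolvesSwapMatching : {s : ℕ} → List Bool → OnlineAlg s → Set
SolvesSwapMatching P A =
  ∀ (t : List Bool) (c : Bool) → length P ≤ length (t ++ [ c ]) →
    (SwapMatches P (lastChars (length P) (t ++ [ c ])) →
       twoThirds ≤ℚ outProb A t c true) ×
    (¬ SwapMatches P (lastChars (length P) (t ++ [ c ])) →
       twoThirds ≤ℚ outProb A t c false)

-- Reduction from indexing. Encode x ∈ {0,1}ⁿ by doubling each bit b into b (1−b) and take the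
-- pattern P = 0 (01)ⁿ 0ʳ 1. After the encoding of x followed by (01)^(j+1) 0ʳ, reading 1 completes
-- the window (1−x_j) enc(x_{j+1} …) (01)^(j+1) 0ʳ 1, which swap-matches P iff x_j = 1: undo the swap
-- inside every block 10, and if x_j = 0 the window has one 1 too many. So the state distribution w_x
-- after enc(x) separates every bit: with g_j(q) the probability of answering 1 from state q,
-- Σ_q w_x(q) g_j(q) is ≥ 2/3 or ≤ 1/3 according to x_j. A majority vote over 288 states sampled from
-- w_x errs on at most n/8 bits for some choice of the samples (second moment bound), so the
-- (2^s)^288 sample tuples decode to words covering {0,1}ⁿ by Hamming balls of radius n/8. A weighted
-- volume count (weight 16 per agreeing bit, 1 per disagreeing bit) gives
-- 2ⁿ 16ⁿ ≤ 2^(288 s) 17ⁿ 16^(n/8), hence s = Ω(n) = Ω(m).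

module Submission where

open import Data.Bool using (Bool; true; false; not; if_then_else_)
open import Data.Fin using (Fin; zero; suc; toℕ)
open import Data.List using (List; []; _∷_; _++_; [_]; length)
open import Data.Product using (Σ; _×_; _,_; proj₁; proj₂; ∃; map₂)
open import Data.Vec using (Vec; []; _∷_; lookup; tabulate)
open import Relation.Binary.PropositionalEquality hiding ([_])
open import Relation.Nullary using (¬_)
import Data.Nat as ℕ
open import Defs

mismatch : Bool → Bool → ℕ.ℕ
mismatch true  true  = 0
mismatch false false = 0
mismatch _     _     = 1

hamming : ∀ {n} → Vec Bool n → Vec Bool n → ℕ.ℕ
hamming []      []      = 0
hamming (a ∷ x) (b ∷ y) = mismatch a b ℕ.+ hamming x y

module Averaging where

  open import Algebra.Bundles using (Semiring; CommutativeRing)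
  open import Data.Empty using (⊥-elim)
  open import Data.Nat using (ℕ; zero; suc)
  import Data.Nat.Properties as ℕ
  open import Data.Sum using (inj₁; inj₂)
  import Data.Vec.Properties as Vec
  import Data.Integer as ℤ
  open import Data.Rational using (ℚ; 0ℚ; 1ℚ; _+_; _*_; -_; _-_; _/_; _≤_; _≤?_; nonNegative)
  import Data.Rational.Properties as ℚ
  open import Data.Rational.Solver using (module +-*-Solver)
  open import Level using (0ℓ)
  open import Relation.Nullary using (Dec; does; yes; no)

  open +-*-Solver

  ℚ-semiring : Semiring 0ℓ 0ℓ
  ℚ-semiring = CommutativeRing.semiring ℚ.+-*-commutativeRing

  open import Algebra.Properties.Semiring.Sum ℚ-semiring
    using ( sum; sum-syntax; sum-cong-≗; sum-replicate; sum-replicate-zero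
          ; ∑-comm; ∑-distrib-+; *-distribˡ-sum; *-distribʳ-sum)
  open import Algebra.Properties.Semiring.Mult ℚ-semiring
    using (×-homo-+; ×1-homo-*; ×-assocˡ; ×-assoc-*) renaming (_×_ to _·_)

  private
    variable
      k : ℕ
      p q r : ℚ

  nonNeg-+ : 0ℚ ≤ p → 0ℚ ≤ q → 0ℚ ≤ p + q
  nonNeg-+ 0≤p 0≤q = ℚ.+-mono-≤ 0≤p 0≤q

  nonNeg-* : 0ℚ ≤ p → 0ℚ ≤ q → 0ℚ ≤ p * q
  nonNeg-* {p} {q} 0≤p 0≤q = ℚ.nonNegative⁻¹ (p * q)
    {{ℚ.nonNeg*nonNeg⇒nonNeg p {{nonNegative 0≤p}} q {{nonNegative 0≤q}}}}

  *-monoʳ-≤ : 0ℚ ≤ r → p ≤ q → r * p ≤ r * q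
  *-monoʳ-≤ {r} 0≤r = ℚ.*-monoˡ-≤-nonNeg r {{nonNegative 0≤r}}

  ≤⇒0≤- : p ≤ q → 0ℚ ≤ q - p
  ≤⇒0≤- {p} {q} p≤q = subst (_≤ q - p) (ℚ.+-inverseʳ p) (ℚ.+-monoˡ-≤ (- p) p≤q)

  0≤-⇒≤ : 0ℚ ≤ q - p → p ≤ q
  0≤-⇒≤ {q} {p} 0≤q-p = subst₂ _≤_ (ℚ.+-identityʳ p) (solve 2 (λ p q → p :+ (q :- p) := q) refl p q)
    (ℚ.+-monoʳ-≤ p 0≤q-p)

  +-cancelˡ-≤ : ∀ r → r + p ≤ r + q → p ≤ q
  +-cancelˡ-≤ {p} {q} r h = 0≤-⇒≤
    (subst (0ℚ ≤_) (solve 3 (λ r p q → (r :+ q) :- (r :+ p) := q :- p) refl r p q) (≤⇒0≤- h))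

  square-nonNeg : ∀ p → 0ℚ ≤ p * p
  square-nonNeg p with ℚ.≤-total 0ℚ p
  ... | inj₁ 0≤p = nonNeg-* 0≤p 0≤p
  ... | inj₂ p≤0 = subst (0ℚ ≤_) (solve 1 (λ p → (:- p) :* (:- p) := p :* p) refl p)
    (nonNeg-* 0≤-p 0≤-p)
    where
    0≤-p : 0ℚ ≤ - p
    0≤-p = subst (0ℚ ≤_) (ℚ.+-identityˡ (- p)) (≤⇒0≤- p≤0)

  square-mono-≤ : 0ℚ ≤ p → p ≤ q → p * p ≤ q * q
  square-mono-≤ {p} {q} 0≤p p≤q = ℚ.≤-trans (*-monoʳ-≤ 0≤p p≤q)
    (subst (_≤ q * q) (ℚ.*-comm q p) (*-monoʳ-≤ (ℚ.≤-trans 0≤p p≤q) p≤q))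

  ·1-nonNeg : ∀ n → 0ℚ ≤ n · 1ℚ
  ·1-nonNeg zero    = ℚ.≤-refl
  ·1-nonNeg (suc n) = nonNeg-+ {1ℚ} {n · 1ℚ} (ℚ.≤ᵇ⇒≤ _) (·1-nonNeg n)

  ·1-cancel-≤ : ∀ m n → m · 1ℚ ≤ n · 1ℚ → m ℕ.≤ n
  ·1-cancel-≤ zero    n       _ = ℕ.z≤n
  ·1-cancel-≤ (suc m) zero    h = ⊥-elim (ℚ.≤⇒≤ᵇ (ℚ.≤-trans 1≤1+m h))
    where
    1≤1+m : 1ℚ ≤ 1ℚ + m · 1ℚ
    1≤1+m = subst (_≤ 1ℚ + m · 1ℚ) (ℚ.+-identityʳ 1ℚ) (ℚ.+-monoʳ-≤ 1ℚ (·1-nonNeg m))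
  ·1-cancel-≤ (suc m) (suc n) h = ℕ.s≤s (·1-cancel-≤ m n (+-cancelˡ-≤ 1ℚ h))

  unit-difference² : 0ℚ ≤ p → p ≤ 1ℚ → 0ℚ ≤ q → q ≤ 1ℚ → (p - q) * (p - q) ≤ 1ℚ
  unit-difference² {p} {q} 0≤p p≤1 0≤q q≤1 = 0≤-⇒≤ (subst (0ℚ ≤_)
    (solve 2 (λ p q → ((con 1ℚ :- p) :+ q) :* ((con 1ℚ :- q) :+ p) := con 1ℚ :- (p :- q) :* (p :- q)) refl p q)
    (nonNeg-* (nonNeg-+ (≤⇒0≤- p≤1) 0≤q) (nonNeg-+ (≤⇒0≤- q≤1) 0≤p)))

  sumFin≡sum : (f : Fin k → ℚ) → sumFin f ≡ sum f
  sumFin≡sum {zero}  f = refl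
  sumFin≡sum {suc k} f = cong (f zero +_) (sumFin≡sum (λ i → f (suc i)))

  sum-mono-≤ : {f g : Fin k → ℚ} → (∀ i → f i ≤ g i) → sum f ≤ sum g
  sum-mono-≤ {zero}  f≤g = ℚ.≤-refl
  sum-mono-≤ {suc k} f≤g = ℚ.+-mono-≤ (f≤g zero) (sum-mono-≤ (λ i → f≤g (suc i)))

  sum-nonNeg : {f : Fin k → ℚ} → (∀ i → 0ℚ ≤ f i) → 0ℚ ≤ sum f
  sum-nonNeg {k} {f} 0≤f = subst (_≤ sum f) (sum-replicate-zero k) (sum-mono-≤ {g = f} 0≤f)

  argmin : (a : Fin (suc k) → ℚ) → ∃ λ i → ∀ j → a i ≤ a j
  argmin {zero}  a = zero , λ { zero → ℚ.≤-refl }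
  argmin {suc k} a with argmin (λ i → a (suc i))
  ... | i , min with ℚ.≤-total (a zero) (a (suc i))
  ...   | inj₁ a₀≤aᵢ = zero  , λ { zero → ℚ.≤-refl ; (suc j) → ℚ.≤-trans a₀≤aᵢ (min j) }
  ...   | inj₂ aᵢ≤a₀ = suc i , λ { zero → aᵢ≤a₀    ; (suc j) → min j }

  IsDistribution : (Fin k → ℚ) → Set
  IsDistribution w = (∀ i → 0ℚ ≤ w i) × sum w ≡ 1ℚ

  module _ (w : Fin k → ℚ) where

    mean-const : sum w ≡ 1ℚ → ∀ c → ∑[ i < k ] (w i * c) ≡ c
    mean-const ∑w≡1 c = begin
      ∑[ i < k ] (w i * c) ≡⟨ *-distribʳ-sum c w ⟨
      sum w * c            ≡⟨ cong (_* c) ∑w≡1 ⟩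
      1ℚ * c               ≡⟨ ℚ.*-identityˡ c ⟩
      c                    ∎
      where open ≡-Reasoning

    mean-mono-≤ : (∀ i → 0ℚ ≤ w i) → {a b : Fin k → ℚ} → (∀ i → a i ≤ b i) →
      ∑[ i < k ] (w i * a i) ≤ ∑[ i < k ] (w i * b i)
    mean-mono-≤ w≥0 a≤b = sum-mono-≤ (λ i → *-monoʳ-≤ (w≥0 i) (a≤b i))

  mean-complement : {w : Fin k → ℚ} → sum w ≡ 1ℚ → {a b : Fin k → ℚ} → (∀ i → a i + b i ≡ 1ℚ) →
    ∑[ i < k ] (w i * a i) + ∑[ i < k ] (w i * b i) ≡ 1ℚ
  mean-complement {k} {w} ∑w≡1 {a} {b} a+b≡1 = begin
    ∑[ i < k ] (w i * a i) + ∑[ i < k ] (w i * b i) ≡⟨ ∑-distrib-+ (λ i → w i * a i) (λ i → w i * b i) ⟨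
    ∑[ i < k ] (w i * a i + w i * b i)              ≡⟨ sum-cong-≗ (λ i → sym (ℚ.*-distribˡ-+ (w i) (a i) (b i))) ⟩
    ∑[ i < k ] (w i * (a i + b i))                  ≡⟨ sum-cong-≗ (λ i → cong (w i *_) (a+b≡1 i)) ⟩
    ∑[ i < k ] (w i * 1ℚ)                           ≡⟨ mean-const w ∑w≡1 1ℚ ⟩
    1ℚ                                              ∎
    where open ≡-Reasoning

  ∃≤mean : {w : Fin k → ℚ} → IsDistribution w → (a : Fin k → ℚ) → ∃ λ i → a i ≤ ∑[ j < k ] (w j * a j)
  ∃≤mean {zero}  (_ , ()) a
  ∃≤mean {suc k} {w} (w≥0 , ∑w≡1) a with argmin a
  ... | i , min = i , subst (_≤ ∑[ j < suc k ] (w j * a j)) (mean-const w ∑w≡1 (a i)) (mean-mono-≤ w w≥0 min)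

  pointMass : Fin k → Fin k → ℚ
  pointMass zero    zero    = 1ℚ
  pointMass zero    (suc _) = 0ℚ
  pointMass (suc _) zero    = 0ℚ
  pointMass (suc i) (suc j) = pointMass i j

  pointMass-sym : (i j : Fin k) → pointMass i j ≡ pointMass j i
  pointMass-sym zero    zero    = refl
  pointMass-sym zero    (suc j) = refl
  pointMass-sym (suc i) zero    = refl
  pointMass-sym (suc i) (suc j) = pointMass-sym i j

  mean-pointMass : (i : Fin k) (f : Fin k → ℚ) → ∑[ j < k ] (pointMass i j * f j) ≡ f i
  mean-pointMass {suc k} zero    f = begin
    1ℚ * f zero + ∑[ j < k ] (0ℚ * f (suc j)) ≡⟨ cong₂ _+_ (ℚ.*-identityˡ (f zero))
                                                    (sum-cong-≗ (λ j → ℚ.*-zeroˡ (f (suc j)))) ⟩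
    f zero + sum {k} (λ _ → 0ℚ)              ≡⟨ cong (f zero +_) (sum-replicate-zero k) ⟩
    f zero + 0ℚ                               ≡⟨ ℚ.+-identityʳ (f zero) ⟩
    f zero                                    ∎
    where open ≡-Reasoning
  mean-pointMass {suc k} (suc i) f =
    trans (cong₂ _+_ (ℚ.*-zeroˡ (f zero)) (mean-pointMass i (λ j → f (suc j)))) (ℚ.+-identityˡ (f (suc i)))

  pointMass-nonNeg : (i j : Fin k) → 0ℚ ≤ pointMass i j
  pointMass-nonNeg zero    zero    = ℚ.≤ᵇ⇒≤ _
  pointMass-nonNeg zero    (suc j) = ℚ.≤-refl
  pointMass-nonNeg (suc i) zero    = ℚ.≤-refl
  pointMass-nonNeg (suc i) (suc j) = pointMass-nonNeg i j

  pointMass-isDistribution : (i : Fin k) → IsDistribution (pointMass i)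
  pointMass-isDistribution i = pointMass-nonNeg i ,
    trans (sum-cong-≗ (λ j → sym (ℚ.*-identityʳ (pointMass i j)))) (mean-pointMass i (λ _ → 1ℚ))

  -- Independent samples

  sampleSum : ∀ {d k} → (Fin d → ℚ) → Vec (Fin d) k → ℚ
  sampleSum {k = k} h σ = ∑[ i < k ] h (lookup σ i)

  sampleSum-shift : ∀ {d k} (h : Fin d → ℚ) (c : ℚ) (σ : Vec (Fin d) k) →
    sampleSum (λ q → h q - c) σ ≡ sampleSum h σ - k · c
  sampleSum-shift h c []                = solve 1 (λ c → con 0ℚ := con 0ℚ :- con 0ℚ) refl c
  sampleSum-shift {k = suc k} h c (q ∷ σ) = trans (cong (h q - c +_) (sampleSum-shift h c σ))
    (solve 4 (λ a s n c → (a :- c) :+ (s :- n) := (a :+ s) :- (c :+ n)) refl (h q) (sampleSum h σ) (k · c) c)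

  sampleSum² : ∀ {d k} → (Fin d → ℚ) → Vec (Fin d) k → ℚ
  sampleSum² h σ = sampleSum h σ * sampleSum h σ

  module Sampling {d : ℕ} {w : Fin d → ℚ} (w-dist : IsDistribution w) where

    private
      w≥0 = proj₁ w-dist
      ∑w≡1 = proj₂ w-dist

    𝔼 : ∀ k → (Vec (Fin d) k → ℚ) → ℚ
    𝔼 zero    F = F []
    𝔼 (suc k) F = ∑[ q < d ] (w q * 𝔼 k (λ σ → F (q ∷ σ)))

    𝔼-cong : ∀ k {F G : Vec (Fin d) k → ℚ} → (∀ σ → F σ ≡ G σ) → 𝔼 k F ≡ 𝔼 k G
    𝔼-cong zero    F≡G = F≡G []
    𝔼-cong (suc k) F≡G = sum-cong-≗ (λ q → cong (w q *_) (𝔼-cong k (λ σ → F≡G (q ∷ σ))))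

    𝔼-+ : ∀ k (F G : Vec (Fin d) k → ℚ) → 𝔼 k (λ σ → F σ + G σ) ≡ 𝔼 k F + 𝔼 k G
    𝔼-+ zero    F G = refl
    𝔼-+ (suc k) F G = trans
      (sum-cong-≗ (λ q → trans (cong (w q *_) (𝔼-+ k (λ σ → F (q ∷ σ)) (λ σ → G (q ∷ σ))))
                               (ℚ.*-distribˡ-+ (w q) _ _)))
      (∑-distrib-+ (λ q → w q * 𝔼 k (λ σ → F (q ∷ σ))) (λ q → w q * 𝔼 k (λ σ → G (q ∷ σ))))

    𝔼-* : ∀ k c (F : Vec (Fin d) k → ℚ) → 𝔼 k (λ σ → c * F σ) ≡ c * 𝔼 k F
    𝔼-* zero    c F = refl
    𝔼-* (suc k) c F = trans
      (sum-cong-≗ (λ q → trans (cong (w q *_) (𝔼-* k c (λ σ → F (q ∷ σ))))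
        (solve 3 (λ a b x → a :* (b :* x) := b :* (a :* x)) refl (w q) c (𝔼 k (λ σ → F (q ∷ σ))))))
      (sym (*-distribˡ-sum c (λ q → w q * 𝔼 k (λ σ → F (q ∷ σ)))))

    𝔼-const : ∀ k c → 𝔼 k (λ _ → c) ≡ c
    𝔼-const zero    c = refl
    𝔼-const (suc k) c = trans (sum-cong-≗ (λ q → cong (w q *_) (𝔼-const k c))) (mean-const w ∑w≡1 c)

    𝔼-sum : ∀ k {n} (F : Fin n → Vec (Fin d) k → ℚ) →
      𝔼 k (λ σ → ∑[ j < n ] F j σ) ≡ ∑[ j < n ] 𝔼 k (F j)
    𝔼-sum k {zero}  F = 𝔼-const k 0ℚ
    𝔼-sum k {suc n} F = trans (𝔼-+ k (F zero) (λ σ → ∑[ j < n ] F (suc j) σ))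
      (cong (𝔼 k (F zero) +_) (𝔼-sum k (λ j → F (suc j))))

    ∃≤𝔼 : ∀ k (F : Vec (Fin d) k → ℚ) → ∃ λ σ → F σ ≤ 𝔼 k F
    ∃≤𝔼 zero    F = [] , ℚ.≤-refl
    ∃≤𝔼 (suc k) F with ∃≤mean w-dist (λ q → 𝔼 k (λ σ → F (q ∷ σ)))
    ... | q , below with ∃≤𝔼 k (λ σ → F (q ∷ σ))
    ...   | σ , below′ = q ∷ σ , ℚ.≤-trans below′ below

    module _ (h : Fin d → ℚ) (h-centred : ∑[ q < d ] (w q * h q) ≡ 0ℚ) where

      -- The cross terms vanish because h is centred.
      𝔼-sampleSum²-step : ∀ k → 𝔼 (suc k) (sampleSum² h) ≡ ∑[ q < d ] (w q * (h q * h q)) + 𝔼 k (sampleSum² h)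
      𝔼-sampleSum²-step k = begin
        ∑[ q < d ] (w q * 𝔼 k (λ σ → (h q + S σ) * (h q + S σ)))
          ≡⟨ sum-cong-≗ (λ q → cong (w q *_) (expand q)) ⟩
        ∑[ q < d ] (w q * (h q * h q + (h q + h q) * ES + ES²))
          ≡⟨ sum-cong-≗ (λ q → solve 4 (λ w a e f → w :* (a :* a :+ (a :+ a) :* e :+ f)
               := w :* (a :* a) :+ (w :* a) :* (e :+ e) :+ w :* f) refl (w q) (h q) ES ES²) ⟩
        ∑[ q < d ] (w q * (h q * h q) + (w q * h q) * (ES + ES) + w q * ES²)
          ≡⟨ ∑-distrib-+ (λ q → w q * (h q * h q) + (w q * h q) * (ES + ES)) (λ q → w q * ES²) ⟩
        ∑[ q < d ] (w q * (h q * h q) + (w q * h q) * (ES + ES)) + ∑[ q < d ] (w q * ES²)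
          ≡⟨ cong₂ _+_ (∑-distrib-+ (λ q → w q * (h q * h q)) (λ q → (w q * h q) * (ES + ES)))
                       (mean-const w ∑w≡1 ES²) ⟩
        ∑[ q < d ] (w q * (h q * h q)) + ∑[ q < d ] ((w q * h q) * (ES + ES)) + ES²
          ≡⟨ cong (λ x → ∑[ q < d ] (w q * (h q * h q)) + x + ES²)
               (trans (sym (*-distribʳ-sum (ES + ES) (λ q → w q * h q)))
                 (trans (cong (_* (ES + ES)) h-centred) (ℚ.*-zeroˡ (ES + ES)))) ⟩
        ∑[ q < d ] (w q * (h q * h q)) + 0ℚ + ES²
          ≡⟨ cong (_+ ES²) (ℚ.+-identityʳ (∑[ q < d ] (w q * (h q * h q)))) ⟩
        ∑[ q < d ] (w q * (h q * h q)) + ES² ∎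
        where
        open ≡-Reasoning
        S : ∀ {k} → Vec (Fin d) k → ℚ
        S = sampleSum h
        ES = 𝔼 k S
        ES² = 𝔼 k (sampleSum² h)
        expand : ∀ q → 𝔼 k (λ σ → (h q + S σ) * (h q + S σ)) ≡ h q * h q + (h q + h q) * ES + ES²
        expand q = begin
          𝔼 k (λ σ → (a + S σ) * (a + S σ))
            ≡⟨ 𝔼-cong k (λ σ → solve 2 (λ a s → (a :+ s) :* (a :+ s) := a :* a :+ ((a :+ a) :* s :+ s :* s))
                 refl a (S σ)) ⟩
          𝔼 k (λ σ → a * a + ((a + a) * S σ + sampleSum² h σ))
            ≡⟨ 𝔼-+ k (λ _ → a * a) (λ σ → (a + a) * S σ + sampleSum² h σ) ⟩
          𝔼 k (λ _ → a * a) + 𝔼 k (λ σ → (a + a) * S σ + sampleSum² h σ)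
            ≡⟨ cong₂ _+_ (𝔼-const k (a * a)) (𝔼-+ k (λ σ → (a + a) * S σ) (sampleSum² h)) ⟩
          a * a + (𝔼 k (λ σ → (a + a) * S σ) + ES²)
            ≡⟨ cong (λ x → a * a + (x + ES²)) (𝔼-* k (a + a) S) ⟩
          a * a + ((a + a) * ES + ES²)
            ≡⟨ ℚ.+-assoc (a * a) _ _ ⟨
          a * a + (a + a) * ES + ES² ∎
          where a = h q

      𝔼-sampleSum²≤ : (∀ q → h q * h q ≤ 1ℚ) → ∀ k → 𝔼 k (sampleSum² h) ≤ k · 1ℚ
      𝔼-sampleSum²≤ h²≤1 zero    = ℚ.≤-reflexive (ℚ.*-zeroˡ 0ℚ)
      𝔼-sampleSum²≤ h²≤1 (suc k) = subst (_≤ 1ℚ + k · 1ℚ) (sym (𝔼-sampleSum²-step k))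
        (ℚ.+-mono-≤ (subst (∑[ q < d ] (w q * (h q * h q)) ≤_) (mean-const w ∑w≡1 1ℚ) (mean-mono-≤ w w≥0 h²≤1))
                    (𝔼-sampleSum²≤ h²≤1 k))

  -- Majority decoding

  hamming-·-sum : ∀ {n} (x y : Vec Bool n) (c : ℚ) →
    hamming x y · c ≡ ∑[ j < n ] (mismatch (lookup x j) (lookup y j) · c)
  hamming-·-sum []      []      c = refl
  hamming-·-sum (a ∷ x) (b ∷ y) c =
    trans (×-homo-+ c (mismatch a b) (hamming x y)) (cong (mismatch a b · c +_) (hamming-·-sum x y c))

  oneThird : ℚ
  oneThird = ℤ.+ 1 / 3

  Separates : Bool → ℚ → Set
  Separates true  p = twoThirds ≤ p
  Separates false p = p ≤ oneThird

  separates-from : ∀ b {M : Set} {p q} → p + q ≡ 1ℚ → (M → twoThirds ≤ p) → (¬ M → twoThirds ≤ q) →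
    (if b then M else ¬ M) → Separates b p
  separates-from true              _     M⇒ _   m  = M⇒ m
  separates-from false {p = p} {q} p+q≡1 _  ¬M⇒ ¬m = 0≤-⇒≤ (subst (0ℚ ≤_) q-⅔≡⅓-p (≤⇒0≤- (¬M⇒ ¬m)))
    where
    q-⅔≡⅓-p : q - twoThirds ≡ oneThird - p
    q-⅔≡⅓-p = trans (solve 2 (λ p q → q :- con twoThirds := ((p :+ q) :- p) :- con twoThirds) refl p q)
      (trans (cong (λ t → (t - p) - twoThirds) p+q≡1)
             (solve 1 (λ p → (con 1ℚ :- p) :- con twoThirds := con oneThird :- p) refl p))

  majority : ℚ → Bool
  majority total = not (does (total ≤? 144 · 1ℚ))

  -- The vote over 288 samples is decided by comparing the total with 144;
  -- a wrong vote puts the total at distance at least 48 from its mean 288 p.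
  wrong-vote-cost : ∀ b total p → Separates b p →
    mismatch b (majority total) · (2304 · 1ℚ) ≤ (total - 288 · p) * (total - 288 · p)
  wrong-vote-cost b total p sep = cost b (total ≤? 144 · 1ℚ) sep
    where
    δ = total - 288 · p
    48² = 2304 · 1ℚ

    288·p≡ : 288 · p ≡ (288 · 1ℚ) * p
    288·p≡ = trans (cong (288 ·_) (sym (ℚ.*-identityˡ p))) (sym (×-assoc-* 288 1ℚ p))

    48²≡ : (48 · 1ℚ) * (48 · 1ℚ) ≡ 1 · 48²
    48²≡ = trans (sym (×1-homo-* 48 48)) (sym (ℚ.+-identityʳ 48²))

    cost : ∀ b → (d : Dec (total ≤ 144 · 1ℚ)) → Separates b p → mismatch b (not (does d)) · 48² ≤ δ * δ
    cost true  (yes total≤144) 2/3≤p = subst₂ _≤_ 48²≡ (solve 1 (λ δ → (:- δ) :* (:- δ) := δ :* δ) refl δ)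
      (square-mono-≤ {48 · 1ℚ} { - δ} (·1-nonNeg 48) (0≤-⇒≤ (subst (0ℚ ≤_) shift
        (nonNeg-+ (≤⇒0≤- total≤144) (nonNeg-* (·1-nonNeg 288) (≤⇒0≤- 2/3≤p))))))
      where
      shift : (144 · 1ℚ - total) + (288 · 1ℚ) * (p - twoThirds) ≡ - δ - 48 · 1ℚ
      shift = trans (solve 2 (λ t p → (con (144 · 1ℚ) :- t) :+ con (288 · 1ℚ) :* (p :- con twoThirds)
                                 := (:- (t :- con (288 · 1ℚ) :* p)) :- con (48 · 1ℚ)) refl total p)
                    (cong (λ x → - (total - x) - 48 · 1ℚ) (sym 288·p≡))
    cost false (no total≰144) p≤1/3 = subst₂ _≤_ 48²≡ refl
      (square-mono-≤ {48 · 1ℚ} {δ} (·1-nonNeg 48) (0≤-⇒≤ (subst (0ℚ ≤_) shift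
        (nonNeg-+ (≤⇒0≤- (ℚ.<⇒≤ (ℚ.≰⇒> total≰144))) (nonNeg-* (·1-nonNeg 288) (≤⇒0≤- p≤1/3))))))
      where
      shift : (total - 144 · 1ℚ) + (288 · 1ℚ) * (oneThird - p) ≡ δ - 48 · 1ℚ
      shift = trans (solve 2 (λ t p → (t :- con (144 · 1ℚ)) :+ con (288 · 1ℚ) :* (con oneThird :- p)
                                 := (t :- con (288 · 1ℚ) :* p) :- con (48 · 1ℚ)) refl total p)
                    (cong (λ x → total - x - 48 · 1ℚ) (sym 288·p≡))
    cost true  (no _)  _ = square-nonNeg δ
    cost false (yes _) _ = square-nonNeg δ

  module Decoding {n d : ℕ}
    (w : Vec Bool n → Fin d → ℚ) (w-dist : ∀ x → IsDistribution (w x))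
    (g : Fin n → Fin d → ℚ) (g≥0 : ∀ j q → 0ℚ ≤ g j q) (g≤1 : ∀ j q → g j q ≤ 1ℚ)
    (separates : ∀ x j → Separates (lookup x j) (∑[ q < d ] (w x q * g j q))) where

    decode : Vec (Fin d) 288 → Vec Bool n
    decode σ = tabulate (λ j → majority (sampleSum (g j) σ))

    module _ (x : Vec Bool n) where
      open Sampling (w-dist x)

      prob : Fin n → ℚ
      prob j = ∑[ q < d ] (w x q * g j q)

      centred : Fin n → Fin d → ℚ
      centred j q = g j q - prob j

      centred-mean : ∀ j → ∑[ q < d ] (w x q * centred j q) ≡ 0ℚ
      centred-mean j = begin
        ∑[ q < d ] (w x q * (g j q - prob j))
          ≡⟨ sum-cong-≗ (λ q → ℚ.*-distribˡ-+ (w x q) (g j q) (- prob j)) ⟩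
        ∑[ q < d ] (w x q * g j q + w x q * - prob j)
          ≡⟨ ∑-distrib-+ (λ q → w x q * g j q) (λ q → w x q * - prob j) ⟩
        prob j + ∑[ q < d ] (w x q * - prob j)
          ≡⟨ cong (prob j +_) (mean-const (w x) (proj₂ (w-dist x)) (- prob j)) ⟩
        prob j - prob j
          ≡⟨ ℚ.+-inverseʳ (prob j) ⟩
        0ℚ ∎
        where open ≡-Reasoning

      prob≥0 : ∀ j → 0ℚ ≤ prob j
      prob≥0 j = sum-nonNeg (λ q → nonNeg-* (proj₁ (w-dist x) q) (g≥0 j q))

      prob≤1 : ∀ j → prob j ≤ 1ℚ
      prob≤1 j = subst (prob j ≤_) (mean-const (w x) (proj₂ (w-dist x)) 1ℚ)
        (mean-mono-≤ (w x) (proj₁ (w-dist x)) (g≤1 j))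

      deviation : Vec (Fin d) 288 → ℚ
      deviation σ = ∑[ j < n ] sampleSum² (centred j) σ

      𝔼-deviation≤ : 𝔼 288 deviation ≤ n · (288 · 1ℚ)
      𝔼-deviation≤ = subst₂ _≤_ (sym (𝔼-sum 288 (λ j → sampleSum² (centred j)))) (sum-replicate n)
        (sum-mono-≤ (λ j → 𝔼-sampleSum²≤ (centred j) (centred-mean j)
          (λ q → unit-difference² (g≥0 j q) (g≤1 j q) (prob≥0 j) (prob≤1 j)) 288))

      wrong-votes≤deviation : ∀ σ →
        hamming x (decode σ) · (2304 · 1ℚ) ≤ deviation σ
      wrong-votes≤deviation σ = subst (_≤ deviation σ) (sym (hamming-·-sum x (decode σ) (2304 · 1ℚ)))
        (sum-mono-≤ λ j → subst₂ _≤_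
          (cong (λ b → mismatch (lookup x j) b · (2304 · 1ℚ)) (sym (Vec.lookup∘tabulate _ j)))
          (cong (λ s → s * s) (sym (sampleSum-shift (g j) (prob j) σ)))
          (wrong-vote-cost (lookup x j) (sampleSum (g j) σ) (prob j) (separates x j)))

      hamming-decode≤ : ∀ σ → deviation σ ≤ n · (288 · 1ℚ) → hamming x (decode σ) ℕ.* 8 ℕ.≤ n
      hamming-decode≤ σ small = ℕ.*-cancelʳ-≤ (hamming x (decode σ) ℕ.* 8) n 288
        (subst (ℕ._≤ n ℕ.* 288) (sym (ℕ.*-assoc (hamming x (decode σ)) 8 288))
          (·1-cancel-≤ (hamming x (decode σ) ℕ.* 2304) (n ℕ.* 288)
            (subst₂ _≤_ (×-assocˡ 1ℚ (hamming x (decode σ)) 2304) (×-assocˡ 1ℚ n 288)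
              (ℚ.≤-trans (wrong-votes≤deviation σ) small))))

    decode-close : ∀ x → ∃ λ σ → hamming x (decode σ) ℕ.* 8 ℕ.≤ n
    decode-close x = map₂ (λ {σ} D≤𝔼D → hamming-decode≤ x σ (ℚ.≤-trans D≤𝔼D (𝔼-deviation≤ x)))
      (Sampling.∃≤𝔼 (w-dist x) 288 (deviation x))


module Linearity {s : ℕ.ℕ} (A : OnlineAlg s) where

  open import Data.Rational using (ℚ; 0ℚ; 1ℚ; _+_; _*_; _≤_)
  import Data.Rational.Properties as ℚ
  open Averaging
  open import Algebra.Properties.Semiring.Sum ℚ-semiring
    using (sum; sum-syntax; sum-cong-≗; ∑-comm; ∑-distrib-+; *-distribˡ-sum; *-distribʳ-sum)

  open OnlineAlg A

  private
    N = 2 ℕ.^ s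
    State = Fin N

  transition : State → Bool → State → ℚ
  transition q c q′ = sumBool (λ b → step q c q′ b)

  emission : State → Bool → Bool → ℚ
  emission q c b = ∑[ q′ < N ] step q c q′ b

  nextDist-sum : ∀ d c q′ → nextDist A d c q′ ≡ ∑[ q < N ] (d q * transition q c q′)
  nextDist-sum d c q′ = sumFin≡sum (λ q → d q * transition q c q′)

  outProb-sum : ∀ t c b → outProb A t c b ≡ ∑[ q < N ] (stateDist A t q * emission q c b)
  outProb-sum t c b = trans (sumFin≡sum (λ q → stateDist A t q * sumFin (λ q′ → step q c q′ b)))
    (sum-cong-≗ (λ q → cong (stateDist A t q *_) (sumFin≡sum (λ q′ → step q c q′ b))))

  runFrom-++ : ∀ d u v → runFrom A d (u ++ v) ≡ runFrom A (runFrom A d u) v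
  runFrom-++ d []      v = refl
  runFrom-++ d (c ∷ u) v = runFrom-++ (nextDist A d c) u v

  runFromState : List Bool → State → State → ℚ
  runFromState u q₀ = runFrom A (pointMass q₀) u

  runFrom-linear : ∀ u d q → runFrom A d u q ≡ ∑[ q₀ < N ] (d q₀ * runFromState u q₀ q)
  runFrom-linear []      d q = sym (trans
    (sum-cong-≗ (λ q₀ → trans (ℚ.*-comm (d q₀) (pointMass q₀ q)) (cong (_* d q₀) (pointMass-sym q₀ q))))
    (mean-pointMass q d))
  runFrom-linear (c ∷ u) d q = begin
    runFrom A (nextDist A d c) u q
      ≡⟨ runFrom-linear u (nextDist A d c) q ⟩
    ∑[ q₁ < N ] (nextDist A d c q₁ * R q₁)
      ≡⟨ sum-cong-≗ (λ q₁ → cong (_* R q₁) (nextDist-sum d c q₁)) ⟩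
    ∑[ q₁ < N ] (∑[ q₀ < N ] (d q₀ * transition q₀ c q₁) * R q₁)
      ≡⟨ sum-cong-≗ (λ q₁ → *-distribʳ-sum (R q₁) (λ q₀ → d q₀ * transition q₀ c q₁)) ⟩
    ∑[ q₁ < N ] ∑[ q₀ < N ] (d q₀ * transition q₀ c q₁ * R q₁)
      ≡⟨ ∑-comm (λ q₁ q₀ → d q₀ * transition q₀ c q₁ * R q₁) ⟩
    ∑[ q₀ < N ] ∑[ q₁ < N ] (d q₀ * transition q₀ c q₁ * R q₁)
      ≡⟨ sum-cong-≗ (λ q₀ → trans (sum-cong-≗ (λ q₁ → ℚ.*-assoc (d q₀) (transition q₀ c q₁) (R q₁)))
                                  (sym (*-distribˡ-sum (d q₀) (λ q₁ → transition q₀ c q₁ * R q₁)))) ⟩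
    ∑[ q₀ < N ] (d q₀ * ∑[ q₁ < N ] (transition q₀ c q₁ * R q₁))
      ≡⟨ sum-cong-≗ (λ q₀ → cong (d q₀ *_) (sym (trans (runFrom-linear u (nextDist A (pointMass q₀) c) q)
           (sum-cong-≗ (λ q₁ → cong (_* R q₁) (trans (nextDist-sum (pointMass q₀) c q₁)
                                                     (mean-pointMass q₀ (λ q → transition q c q₁)))))))) ⟩
    ∑[ q₀ < N ] (d q₀ * runFromState (c ∷ u) q₀ q) ∎
    where
    open ≡-Reasoning
    R : State → ℚ
    R q₁ = runFromState u q₁ q

  transition-nonNeg : ∀ q c q′ → 0ℚ ≤ transition q c q′
  transition-nonNeg q c q′ = nonNeg-+ (step-nonneg q c q′ false) (step-nonneg q c q′ true)

  emission-nonNeg : ∀ q c b → 0ℚ ≤ emission q c b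
  emission-nonNeg q c b = sum-nonNeg (λ q′ → step-nonneg q c q′ b)

  emission-sum : ∀ q c → emission q c true + emission q c false ≡ 1ℚ
  emission-sum q c = begin
    emission q c true + emission q c false
      ≡⟨ ℚ.+-comm (emission q c true) _ ⟩
    emission q c false + emission q c true
      ≡⟨ ∑-distrib-+ (λ q′ → step q c q′ false) (λ q′ → step q c q′ true) ⟨
    ∑[ q′ < N ] transition q c q′
      ≡⟨ sumFin≡sum (λ q′ → transition q c q′) ⟨
    sumFin (λ q′ → transition q c q′)
      ≡⟨ step-sum q c ⟩
    1ℚ ∎
    where open ≡-Reasoning

  nextDist-isDistribution : ∀ {d} c → IsDistribution d → IsDistribution (nextDist A d c)
  nextDist-isDistribution {d} c (d≥0 , ∑d≡1) =
    (λ q′ → subst (0ℚ ≤_) (sym (nextDist-sum d c q′))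
              (sum-nonNeg (λ q → nonNeg-* (d≥0 q) (transition-nonNeg q c q′)))) ,
    (begin
      ∑[ q′ < N ] nextDist A d c q′
        ≡⟨ sum-cong-≗ (nextDist-sum d c) ⟩
      ∑[ q′ < N ] ∑[ q < N ] (d q * transition q c q′)
        ≡⟨ ∑-comm (λ q′ q → d q * transition q c q′) ⟩
      ∑[ q < N ] ∑[ q′ < N ] (d q * transition q c q′)
        ≡⟨ sum-cong-≗ (λ q → *-distribˡ-sum (d q) (λ q′ → transition q c q′)) ⟨
      ∑[ q < N ] (d q * ∑[ q′ < N ] transition q c q′)
        ≡⟨ sum-cong-≗ (λ q → cong (d q *_) (trans (sym (sumFin≡sum (λ q′ → transition q c q′))) (step-sum q c))) ⟩
      ∑[ q < N ] (d q * 1ℚ)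
        ≡⟨ sum-cong-≗ (λ q → ℚ.*-identityʳ (d q)) ⟩
      sum d
        ≡⟨ ∑d≡1 ⟩
      1ℚ ∎)
    where open ≡-Reasoning

  runFrom-isDistribution : ∀ {d} u → IsDistribution d → IsDistribution (runFrom A d u)
  runFrom-isDistribution []      d-dist = d-dist
  runFrom-isDistribution (c ∷ u) d-dist = runFrom-isDistribution u (nextDist-isDistribution c d-dist)

  stateDist-isDistribution : ∀ t → IsDistribution (stateDist A t)
  stateDist-isDistribution t = runFrom-isDistribution t (init-nonneg , trans (sym (sumFin≡sum init)) init-sum)

  emissionAfter : List Bool → Bool → Bool → State → ℚ
  emissionAfter u c b q₀ = ∑[ q < N ] (runFromState u q₀ q * emission q c b)

  outProb-++ : ∀ t u c b → outProb A (t ++ u) c b ≡ ∑[ q₀ < N ] (stateDist A t q₀ * emissionAfter u c b q₀)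
  outProb-++ t u c b = begin
    outProb A (t ++ u) c b
      ≡⟨ outProb-sum (t ++ u) c b ⟩
    ∑[ q < N ] (runFrom A init (t ++ u) q * emission q c b)
      ≡⟨ sum-cong-≗ (λ q → cong (_* emission q c b)
           (trans (cong (λ d → d q) (runFrom-++ init t u)) (runFrom-linear u (stateDist A t) q))) ⟩
    ∑[ q < N ] (∑[ q₀ < N ] (stateDist A t q₀ * runFromState u q₀ q) * emission q c b)
      ≡⟨ sum-cong-≗ (λ q → *-distribʳ-sum (emission q c b) (λ q₀ → stateDist A t q₀ * runFromState u q₀ q)) ⟩
    ∑[ q < N ] ∑[ q₀ < N ] (stateDist A t q₀ * runFromState u q₀ q * emission q c b)
      ≡⟨ ∑-comm (λ q q₀ → stateDist A t q₀ * runFromState u q₀ q * emission q c b) ⟩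
    ∑[ q₀ < N ] ∑[ q < N ] (stateDist A t q₀ * runFromState u q₀ q * emission q c b)
      ≡⟨ sum-cong-≗ (λ q₀ → trans
           (sum-cong-≗ (λ q → ℚ.*-assoc (stateDist A t q₀) (runFromState u q₀ q) (emission q c b)))
           (sym (*-distribˡ-sum (stateDist A t q₀) (λ q → runFromState u q₀ q * emission q c b)))) ⟩
    ∑[ q₀ < N ] (stateDist A t q₀ * emissionAfter u c b q₀) ∎
    where open ≡-Reasoning

  emissionAfter-nonNeg : ∀ u c b q₀ → 0ℚ ≤ emissionAfter u c b q₀
  emissionAfter-nonNeg u c b q₀ = sum-nonNeg (λ q →
    nonNeg-* (proj₁ (runFrom-isDistribution u (pointMass-isDistribution q₀)) q) (emission-nonNeg q c b))

  emissionAfter-≤1 : ∀ u c q₀ → emissionAfter u c true q₀ ≤ 1ℚ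
  emissionAfter-≤1 u c q₀ = subst (emissionAfter u c true q₀ ≤_)
    (mean-complement (proj₂ (runFrom-isDistribution u (pointMass-isDistribution q₀))) (λ q → emission-sum q c))
    (subst (_≤ emissionAfter u c true q₀ + emissionAfter u c false q₀) (ℚ.+-identityʳ (emissionAfter u c true q₀))
      (ℚ.+-monoʳ-≤ (emissionAfter u c true q₀) (emissionAfter-nonNeg u c false q₀)))

  outProb-complement : ∀ t c → outProb A t c true + outProb A t c false ≡ 1ℚ
  outProb-complement t c = trans (cong₂ _+_ (outProb-sum t c true) (outProb-sum t c false))
    (mean-complement (proj₂ (stateDist-isDistribution t)) (λ q → emission-sum q c))

module HammingBalls where

  open import Data.Nat
  open import Data.Nat.Properties
  open import Data.Nat.Solver using (module +-*-Solver)
  open +-*-Solver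
  open import Algebra.Properties.Semiring.Sum +-*-semiring using (sum; sum-syntax; sum-cong-≗; ∑-distrib-+)

  sumBits : ∀ n → (Vec Bool n → ℕ) → ℕ
  sumBits zero    F = F []
  sumBits (suc n) F = sumBits n (λ x → F (false ∷ x)) + sumBits n (λ x → F (true ∷ x))

  sumBits-cong : ∀ n {F G : Vec Bool n → ℕ} → (∀ x → F x ≡ G x) → sumBits n F ≡ sumBits n G
  sumBits-cong zero    F≡G = F≡G []
  sumBits-cong (suc n) F≡G =
    cong₂ _+_ (sumBits-cong n (λ x → F≡G (false ∷ x))) (sumBits-cong n (λ x → F≡G (true ∷ x)))

  sumBits-mono-≤ : ∀ n {F G : Vec Bool n → ℕ} → (∀ x → F x ≤ G x) → sumBits n F ≤ sumBits n G
  sumBits-mono-≤ zero    F≤G = F≤G []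
  sumBits-mono-≤ (suc n) F≤G =
    +-mono-≤ (sumBits-mono-≤ n (λ x → F≤G (false ∷ x))) (sumBits-mono-≤ n (λ x → F≤G (true ∷ x)))

  sumBits-*ˡ : ∀ n a (F : Vec Bool n → ℕ) → sumBits n (λ x → a * F x) ≡ a * sumBits n F
  sumBits-*ˡ zero    a F = refl
  sumBits-*ˡ (suc n) a F = trans (cong₂ _+_ (sumBits-*ˡ n a _) (sumBits-*ˡ n a _)) (sym (*-distribˡ-+ a _ _))

  sumBits-const : ∀ n c → sumBits n (λ _ → c) ≡ 2 ^ n * c
  sumBits-const zero    c = sym (+-identityʳ c)
  sumBits-const (suc n) c = trans (cong₂ _+_ (sumBits-const n c) (sumBits-const n c))
    (solve 2 (λ x c → x :* c :+ x :* c := (con 2 :* x) :* c) refl (2 ^ n) c)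

  sum-const : ∀ {k} c → sum {k} (λ _ → c) ≡ k * c
  sum-const {zero}  c = refl
  sum-const {suc k} c = cong (c +_) (sum-const {k} c)

  term≤sum : ∀ {k} (f : Fin k → ℕ) i → f i ≤ sum f
  term≤sum f zero    = m≤m+n _ _
  term≤sum f (suc i) = ≤-trans (term≤sum (λ j → f (suc j)) i) (m≤n+m _ _)

  module _ {d : ℕ} where

    sumWords : ∀ k → (Vec (Fin d) k → ℕ) → ℕ
    sumWords zero    F = F []
    sumWords (suc k) F = ∑[ q < d ] sumWords k (λ σ → F (q ∷ σ))

    sumWords-+ : ∀ k (F G : Vec (Fin d) k → ℕ) → sumWords k (λ σ → F σ + G σ) ≡ sumWords k F + sumWords k G
    sumWords-+ zero    F G = refl
    sumWords-+ (suc k) F G = trans (sum-cong-≗ (λ q → sumWords-+ k (λ σ → F (q ∷ σ)) (λ σ → G (q ∷ σ))))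
      (∑-distrib-+ (λ q → sumWords k (λ σ → F (q ∷ σ))) (λ q → sumWords k (λ σ → G (q ∷ σ))))

    sumWords-cong : ∀ k {F G : Vec (Fin d) k → ℕ} → (∀ σ → F σ ≡ G σ) → sumWords k F ≡ sumWords k G
    sumWords-cong zero    F≡G = F≡G []
    sumWords-cong (suc k) F≡G = sum-cong-≗ (λ q → sumWords-cong k (λ σ → F≡G (q ∷ σ)))

    sumWords-const : ∀ k c → sumWords k (λ _ → c) ≡ d ^ k * c
    sumWords-const zero    c = sym (+-identityʳ c)
    sumWords-const (suc k) c = trans (sum-cong-≗ {d} {y = λ _ → d ^ k * c} (λ _ → sumWords-const k c))
      (trans (sum-const {d} (d ^ k * c)) (sym (*-assoc d (d ^ k) c)))

    term≤sumWords : ∀ k (F : Vec (Fin d) k → ℕ) σ → F σ ≤ sumWords k F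
    term≤sumWords zero    F []      = ≤-refl
    term≤sumWords (suc k) F (q ∷ σ) = ≤-trans (term≤sumWords k (λ τ → F (q ∷ τ)) σ)
      (term≤sum (λ q → sumWords k (λ τ → F (q ∷ τ))) q)

    sumBits-sumWords : ∀ n k (F : Vec Bool n → Vec (Fin d) k → ℕ) →
      sumBits n (λ x → sumWords k (F x)) ≡ sumWords k (λ σ → sumBits n (λ x → F x σ))
    sumBits-sumWords zero    k F = refl
    sumBits-sumWords (suc n) k F = trans
      (cong₂ _+_ (sumBits-sumWords n k (λ x → F (false ∷ x))) (sumBits-sumWords n k (λ x → F (true ∷ x))))
      (sym (sumWords-+ k _ _))

  agreementWeight : Bool → Bool → ℕ
  agreementWeight true  true  = 16
  agreementWeight false false = 16
  agreementWeight _     _     = 1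

  weight : ∀ {n} → Vec Bool n → Vec Bool n → ℕ
  weight []      []      = 1
  weight (a ∷ x) (b ∷ y) = agreementWeight a b * weight x y

  weight-hamming : ∀ {n} (x y : Vec Bool n) → weight x y * 16 ^ hamming x y ≡ 16 ^ n
  weight-hamming [] [] = refl
  weight-hamming {suc n} (a ∷ x) (b ∷ y) = begin
    agreementWeight a b * weight x y * 16 ^ (mismatch a b + hamming x y)
      ≡⟨ cong (agreementWeight a b * weight x y *_) (^-distribˡ-+-* 16 (mismatch a b) (hamming x y)) ⟩
    agreementWeight a b * weight x y * (16 ^ mismatch a b * 16 ^ hamming x y)
      ≡⟨ solve 4 (λ u v w z → u :* v :* (w :* z) := (u :* w) :* (v :* z)) refl
           (agreementWeight a b) (weight x y) (16 ^ mismatch a b) (16 ^ hamming x y) ⟩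
    (agreementWeight a b * 16 ^ mismatch a b) * (weight x y * 16 ^ hamming x y)
      ≡⟨ cong₂ _*_ (agreement-16 a b) (weight-hamming x y) ⟩
    16 * 16 ^ n ∎
    where
    open ≡-Reasoning
    agreement-16 : ∀ a b → agreementWeight a b * 16 ^ mismatch a b ≡ 16
    agreement-16 true  true  = refl
    agreement-16 true  false = refl
    agreement-16 false true  = refl
    agreement-16 false false = refl

  sumBits-weight : ∀ n (y : Vec Bool n) → sumBits n (λ x → weight x y) ≡ 17 ^ n
  sumBits-weight zero    []      = refl
  sumBits-weight (suc n) (b ∷ y) = trans
    (cong₂ _+_ (sumBits-*ˡ n (agreementWeight false b) (λ x → weight x y))
               (sumBits-*ˡ n (agreementWeight true b) (λ x → weight x y)))
    (trans (sym (*-distribʳ-+ (sumBits n (λ x → weight x y)) (agreementWeight false b) (agreementWeight true b)))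
           (cong₂ _*_ (weights-17 b) (sumBits-weight n y)))
    where
    weights-17 : ∀ b → agreementWeight false b + agreementWeight true b ≡ 17
    weights-17 true  = refl
    weights-17 false = refl

  -- Every x has weight x y · 16 ^ hamming x y = 16 ^ n, while the weights of all x against a fixed y
  -- sum to 17 ^ n.
  code-size : ∀ {d} n k r (encode : Vec Bool n → Vec (Fin d) k) (decode : Vec (Fin d) k → Vec Bool n) →
    (∀ x → hamming x (decode (encode x)) ≤ r) → 2 ^ n * 16 ^ n ≤ d ^ k * 17 ^ n * 16 ^ r
  code-size {d} n k r encode decode close = begin
    2 ^ n * 16 ^ n
      ≡⟨ sumBits-const n (16 ^ n) ⟨
    sumBits n (λ _ → 16 ^ n)
      ≡⟨ sumBits-cong n (λ x → weight-hamming x (x̂ x)) ⟨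
    sumBits n (λ x → weight x (x̂ x) * 16 ^ hamming x (x̂ x))
      ≤⟨ sumBits-mono-≤ n (λ x → *-mono-≤ (term≤sumWords k (λ σ → weight x (decode σ)) (encode x))
                                           (^-monoʳ-≤ 16 (close x))) ⟩
    sumBits n (λ x → sumWords k (λ σ → weight x (decode σ)) * 16 ^ r)
      ≡⟨ sumBits-cong n (λ x → *-comm _ (16 ^ r)) ⟩
    sumBits n (λ x → 16 ^ r * sumWords k (λ σ → weight x (decode σ)))
      ≡⟨ sumBits-*ˡ n (16 ^ r) _ ⟩
    16 ^ r * sumBits n (λ x → sumWords k (λ σ → weight x (decode σ)))
      ≡⟨ cong (16 ^ r *_) (sumBits-sumWords n k (λ x σ → weight x (decode σ))) ⟩
    16 ^ r * sumWords k (λ σ → sumBits n (λ x → weight x (decode σ)))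
      ≡⟨ cong (16 ^ r *_) (sumWords-cong k (λ σ → sumBits-weight n (decode σ))) ⟩
    16 ^ r * sumWords k (λ _ → 17 ^ n)
      ≡⟨ cong (16 ^ r *_) (sumWords-const k (17 ^ n)) ⟩
    16 ^ r * (d ^ k * 17 ^ n)
      ≡⟨ *-comm (16 ^ r) _ ⟩
    d ^ k * 17 ^ n * 16 ^ r ∎
    where
    open ≤-Reasoning
    x̂ : Vec Bool n → Vec Bool n
    x̂ x = decode (encode x)

module SwapGadget where

  open import Data.Nat
  open import Data.Nat.Properties
  open import Data.List using (List; []; _∷_; _++_; [_]; length; replicate; foldr; map; drop)
  open import Data.List.Properties using (++-assoc; length-++; length-replicate)
  open import Data.List.Relation.Unary.All using (All; []; _∷_)
  open import Data.List.Relation.Unary.AllPairs using (AllPairs; []; _∷_)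
  open import Data.Sum using (inj₁; inj₂)

  ones : List Bool → ℕ
  ones []           = 0
  ones (true  ∷ xs) = suc (ones xs)
  ones (false ∷ xs) = ones xs

  ones-++ : ∀ xs ys → ones (xs ++ ys) ≡ ones xs + ones ys
  ones-++ []           ys = refl
  ones-++ (true  ∷ xs) ys = cong suc (ones-++ xs ys)
  ones-++ (false ∷ xs) ys = ones-++ xs ys

  ones-applySwap : ∀ i xs → ones (applySwap i xs) ≡ ones xs
  ones-applySwap zero    []                   = refl
  ones-applySwap zero    (_ ∷ [])             = refl
  ones-applySwap zero    (true  ∷ true  ∷ xs) = refl
  ones-applySwap zero    (true  ∷ false ∷ xs) = refl
  ones-applySwap zero    (false ∷ true  ∷ xs) = refl
  ones-applySwap zero    (false ∷ false ∷ xs) = refl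
  ones-applySwap (suc i) []                   = refl
  ones-applySwap (suc i) (true  ∷ xs)         = cong suc (ones-applySwap i xs)
  ones-applySwap (suc i) (false ∷ xs)         = ones-applySwap i xs

  swapMatches⇒ones≡ : ∀ {P W} → SwapMatches P W → ones P ≡ ones W
  swapMatches⇒ones≡ {P} (I , _ , _ , swapped) = trans (sym (ones-swaps I)) (cong ones swapped)
    where
    ones-swaps : ∀ I → ones (foldr applySwap P I) ≡ ones P
    ones-swaps []      = refl
    ones-swaps (i ∷ I) = trans (ones-applySwap i (foldr applySwap P I)) (ones-swaps I)

  swapMatches-refl : ∀ (W : List Bool) → SwapMatches W W
  swapMatches-refl W = [] , [] , [] , refl

  private
    shift-valid : ∀ {L} (I : List ℕ) → All (λ i → suc i < L) I → All (λ i → suc i < suc L) (map suc I)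
    shift-valid []      []       = []
    shift-valid (i ∷ I) (v ∷ vs) = s≤s v ∷ shift-valid I vs

    shift-disjoint : ∀ {i} (I : List ℕ) → All (DisjointSwaps i) I → All (DisjointSwaps (suc i)) (map suc I)
    shift-disjoint []      []              = []
    shift-disjoint (j ∷ I) (inj₁ lt ∷ dis) = inj₁ (s≤s lt) ∷ shift-disjoint I dis
    shift-disjoint (j ∷ I) (inj₂ gt ∷ dis) = inj₂ (s≤s gt) ∷ shift-disjoint I dis

    shift-pairwise : ∀ (I : List ℕ) → AllPairs DisjointSwaps I → AllPairs DisjointSwaps (map suc I)
    shift-pairwise []      []         = []
    shift-pairwise (i ∷ I) (dis ∷ ps) = shift-disjoint I dis ∷ shift-pairwise I ps

    shift-swaps : ∀ a (P : List Bool) (I : List ℕ) → foldr applySwap (a ∷ P) (map suc I) ≡ a ∷ foldr applySwap P I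
    shift-swaps a P []      = refl
    shift-swaps a P (i ∷ I) = cong (applySwap (suc i)) (shift-swaps a P I)

    beyond-1 : ∀ (I : List ℕ) → All (DisjointSwaps 0) (map suc (map suc I))
    beyond-1 []      = []
    beyond-1 (i ∷ I) = inj₁ (s≤s (s≤s z≤n)) ∷ beyond-1 I

  swapMatches-∷ : ∀ a {P W} → SwapMatches P W → SwapMatches (a ∷ P) (a ∷ W)
  swapMatches-∷ a {P} (I , valid , disjoint , swapped) =
    map suc I , shift-valid I valid , shift-pairwise I disjoint , trans (shift-swaps a P I) (cong (a ∷_) swapped)

  swapMatches-01 : ∀ {P W} → SwapMatches P W → SwapMatches (false ∷ true ∷ P) (true ∷ false ∷ W)
  swapMatches-01 {P} (I , valid , disjoint , swapped) =
    0 ∷ map suc (map suc I) ,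
    s≤s (s≤s z≤n) ∷ shift-valid (map suc I) (shift-valid I valid) ,
    beyond-1 I ∷ shift-pairwise (map suc I) (shift-pairwise I disjoint) ,
    trans (cong (applySwap 0) (trans (shift-swaps false (true ∷ P) (map suc I)) (cong (false ∷_) (shift-swaps true P I))))
          (cong (λ Z → true ∷ false ∷ Z) swapped)

  pairs : ℕ → List Bool
  pairs zero    = []
  pairs (suc k) = false ∷ true ∷ pairs k

  encode : ∀ {m} → Vec Bool m → List Bool
  encode []      = []
  encode (b ∷ x) = b ∷ not b ∷ encode x

  pairs-swapMatches-encode : ∀ {m} (x : Vec Bool m) Z → SwapMatches (pairs m ++ Z) (encode x ++ Z)
  pairs-swapMatches-encode []          Z = swapMatches-refl Z
  pairs-swapMatches-encode (false ∷ x) Z = swapMatches-∷ false (swapMatches-∷ true (pairs-swapMatches-encode x Z))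
  pairs-swapMatches-encode (true  ∷ x) Z = swapMatches-01 (pairs-swapMatches-encode x Z)

  pairs-+ : ∀ a b → pairs (a + b) ≡ pairs a ++ pairs b
  pairs-+ zero    b = refl
  pairs-+ (suc a) b = cong (λ Z → false ∷ true ∷ Z) (pairs-+ a b)

  ones-pairs : ∀ k → ones (pairs k) ≡ k
  ones-pairs zero    = refl
  ones-pairs (suc k) = cong suc (ones-pairs k)

  ones-encode : ∀ {m} (x : Vec Bool m) → ones (encode x) ≡ m
  ones-encode []          = refl
  ones-encode (true  ∷ x) = cong suc (ones-encode x)
  ones-encode (false ∷ x) = cong suc (ones-encode x)

  length-pairs : ∀ k → length (pairs k) ≡ 2 * k
  length-pairs zero    = refl
  length-pairs (suc k) = trans (cong (2 +_) (length-pairs k)) (sym (*-suc 2 k))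

  length-encode : ∀ {m} (x : Vec Bool m) → length (encode x) ≡ 2 * m
  length-encode []              = refl
  length-encode {suc m} (b ∷ x) = trans (cong (2 +_) (length-encode x)) (sym (*-suc 2 m))

  marker : ℕ → List Bool
  marker r = replicate r false ++ [ true ]

  hardPattern : ℕ → ℕ → List Bool
  hardPattern n r = false ∷ pairs n ++ marker r

  length-hardPattern : ∀ n r → length (hardPattern n r) ≡ 2 + (r + 2 * n)
  length-hardPattern n r = cong suc (begin
    length (pairs n ++ marker r)
      ≡⟨ length-++ (pairs n) ⟩
    length (pairs n) + length (replicate r false ++ [ true ])
      ≡⟨ cong₂ _+_ (length-pairs n) (length-++ (replicate r false)) ⟩
    2 * n + (length (replicate r false) + 1)
      ≡⟨ cong (λ l → 2 * n + (l + 1)) (length-replicate r) ⟩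
    2 * n + (r + 1)
      ≡⟨ +-comm (2 * n) (r + 1) ⟩
    r + 1 + 2 * n
      ≡⟨ cong (_+ 2 * n) (+-comm r 1) ⟩
    suc (r + 2 * n) ∎)
    where open ≡-Reasoning

  query : ℕ → ℕ → List Bool
  query j r = pairs (suc j) ++ replicate r false

  window : ∀ {m} → Bool → Vec Bool m → ℕ → ℕ → List Bool
  window b x′ j r = b ∷ encode x′ ++ pairs (suc j) ++ marker r

  ones-marker : ∀ r → ones (marker r) ≡ 1
  ones-marker zero    = refl
  ones-marker (suc r) = ones-marker r

  module _ {n m j : ℕ} (x′ : Vec Bool m) (r : ℕ) (m+1+j≡n : m + suc j ≡ n) where

    hardPattern-swapMatches-window : SwapMatches (hardPattern n r) (window false x′ j r)
    hardPattern-swapMatches-window = subst (λ P → SwapMatches P (window false x′ j r)) (sym P≡)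
      (swapMatches-∷ false (pairs-swapMatches-encode x′ (pairs (suc j) ++ marker r)))
      where
      P≡ : hardPattern n r ≡ false ∷ pairs m ++ pairs (suc j) ++ marker r
      P≡ = cong (false ∷_) (trans (cong (λ k → pairs k ++ marker r) (sym m+1+j≡n))
             (trans (cong (_++ marker r) (pairs-+ m (suc j))) (++-assoc (pairs m) (pairs (suc j)) (marker r))))

    hardPattern-¬swapMatches-window : ¬ SwapMatches (hardPattern n r) (window true x′ j r)
    hardPattern-¬swapMatches-window match = 1+n≢n (sym (trans (sym ones-P) (trans (swapMatches⇒ones≡ match) ones-W)))
      where
      ones-P : ones (hardPattern n r) ≡ n + 1
      ones-P = trans (ones-++ (pairs n) (marker r)) (cong₂ _+_ (ones-pairs n) (ones-marker r))
      ones-W : ones (window true x′ j r) ≡ suc (n + 1)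
      ones-W = cong suc (begin
        ones (encode x′ ++ pairs (suc j) ++ marker r)
          ≡⟨ ones-++ (encode x′) (pairs (suc j) ++ marker r) ⟩
        ones (encode x′) + ones (pairs (suc j) ++ marker r)
          ≡⟨ cong₂ _+_ (ones-encode x′) (trans (ones-++ (pairs (suc j)) (marker r))
                                              (cong₂ _+_ (ones-pairs (suc j)) (ones-marker r))) ⟩
        m + (suc j + 1)
          ≡⟨ +-assoc m (suc j) 1 ⟨
        m + suc j + 1
          ≡⟨ cong (_+ 1) m+1+j≡n ⟩
        n + 1 ∎)
        where open ≡-Reasoning

    length-window : ∀ b → length (window b x′ j r) ≡ length (hardPattern n r)
    length-window b = cong suc (begin
      length (encode x′ ++ pairs (suc j) ++ marker r)
        ≡⟨ length-++ (encode x′) ⟩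
      length (encode x′) + length (pairs (suc j) ++ marker r)
        ≡⟨ cong₂ _+_ (length-encode x′) (length-++ (pairs (suc j))) ⟩
      2 * m + (length (pairs (suc j)) + length (marker r))
        ≡⟨ cong (λ l → 2 * m + (l + length (marker r))) (length-pairs (suc j)) ⟩
      2 * m + (2 * suc j + length (marker r))
        ≡⟨ +-assoc (2 * m) (2 * suc j) _ ⟨
      2 * m + 2 * suc j + length (marker r)
        ≡⟨ cong (_+ length (marker r)) (trans (sym (*-distribˡ-+ 2 m (suc j))) (cong (2 *_) m+1+j≡n)) ⟩
      2 * n + length (marker r)
        ≡⟨ cong (_+ length (marker r)) (length-pairs n) ⟨
      length (pairs n) + length (marker r)
        ≡⟨ length-++ (pairs n) ⟨
      length (pairs n ++ marker r) ∎)
      where open ≡-Reasoning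

    window-swapMatches : ∀ b → if b then SwapMatches (hardPattern n r) (window (not b) x′ j r)
                                    else ¬ SwapMatches (hardPattern n r) (window (not b) x′ j r)
    window-swapMatches true  = hardPattern-swapMatches-window
    window-swapMatches false = hardPattern-¬swapMatches-window

  encode-split : ∀ {n} (x : Vec Bool n) (j : Fin n) →
    Σ (List Bool) λ pre → Σ ℕ λ m → Σ (Vec Bool m) λ x′ →
      encode x ≡ pre ++ not (lookup x j) ∷ encode x′ × m + suc (toℕ j) ≡ n
  encode-split {suc n} (b ∷ x) zero    = b ∷ [] , n , x , refl , +-comm n 1
  encode-split         (b ∷ x) (suc j) with encode-split x j
  ... | pre , m , x′ , split , len =
    b ∷ not b ∷ pre , m , x′ , cong (λ Z → b ∷ not b ∷ Z) split , trans (+-suc m (suc (toℕ j))) (cong suc len)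

  lastChars-++ : ∀ {k} (pre W : List Bool) → length W ≡ k → lastChars k (pre ++ W) ≡ W
  lastChars-++ {k} pre W refl = trans (cong (λ l → drop (l ∸ length W) (pre ++ W))
    (length-++ pre)) (trans (cong (λ l → drop l (pre ++ W)) (m+n∸n≡m (length pre) (length W))) (drop-++ pre))
    where
    drop-++ : ∀ pre → drop (length pre) (pre ++ W) ≡ W
    drop-++ []        = refl
    drop-++ (_ ∷ pre) = drop-++ pre

  probe : ∀ {n} → Vec Bool n → Fin n → ℕ → List Bool
  probe x j r = encode x ++ query (toℕ j) r

  probe-window : ∀ {n} (x : Vec Bool n) (j : Fin n) r →
    length (hardPattern n r) ≤ length (probe x j r ++ [ true ]) ×
    (if lookup x j then SwapMatches (hardPattern n r) (lastChars (length (hardPattern n r)) (probe x j r ++ [ true ]))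
                   else ¬ SwapMatches (hardPattern n r) (lastChars (length (hardPattern n r)) (probe x j r ++ [ true ])))
  probe-window {n} x j r with encode-split x j
  ... | pre , m , x′ , split , len = subst (λ T → length P ≤ length T) (sym text≡) long ,
    subst (λ W → if lookup x j then SwapMatches P W else ¬ SwapMatches P W) (sym last≡)
      (window-swapMatches x′ r len (lookup x j))
    where
    P = hardPattern n r
    W = window (not (lookup x j)) x′ (toℕ j) r
    text≡ : probe x j r ++ [ true ] ≡ pre ++ W
    text≡ = begin
      (encode x ++ query (toℕ j) r) ++ [ true ]
        ≡⟨ ++-assoc (encode x) (query (toℕ j) r) [ true ] ⟩
      encode x ++ query (toℕ j) r ++ [ true ]
        ≡⟨ cong₂ _++_ split (++-assoc (pairs (suc (toℕ j))) (replicate r false) [ true ]) ⟩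
      (pre ++ not (lookup x j) ∷ encode x′) ++ pairs (suc (toℕ j)) ++ marker r
        ≡⟨ ++-assoc pre (not (lookup x j) ∷ encode x′) _ ⟩
      pre ++ W ∎
      where open ≡-Reasoning
    last≡ : lastChars (length P) (probe x j r ++ [ true ]) ≡ W
    last≡ = trans (cong (lastChars (length P)) text≡) (lastChars-++ pre W (length-window x′ r len (not (lookup x j))))
    long : length P ≤ length (pre ++ W)
    long = subst₂ _≤_ (length-window x′ r len (not (lookup x j))) (sym (length-++ pre)) (m≤n+m (length W) (length pre))

module Arithmetic where

  open import Data.Empty using (⊥-elim)
  open import Data.Nat
  open import Data.Nat.Properties
  open import Data.Nat.Solver using (module +-*-Solver)
  open +-*-Solver

  ^-cancelˡ-≤ : ∀ a b → 2 ^ a ≤ 2 ^ b → a ≤ b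
  ^-cancelˡ-≤ a b 2^a≤2^b = ≮⇒≥ (λ b<a → <⇒≱ (^-monoʳ-< 2 (s≤s (s≤s z≤n)) b<a) 2^a≤2^b)

  -- 17 ^ 8 ≤ 2 ^ 33, so the volume bound gives 2 ^ (40 n′) ≤ 2 ^ (288 s + 37 n′).
  volume⇒3n′≤288s : ∀ n′ s → 2 ^ (8 * n′) * 16 ^ (8 * n′) ≤ (2 ^ s) ^ 288 * 17 ^ (8 * n′) * 16 ^ n′ →
    3 * n′ ≤ 288 * s
  volume⇒3n′≤288s n′ s volume = +-cancelʳ-≤ (37 * n′) (3 * n′) (288 * s)
    (subst₂ _≤_ (solve 1 (λ n → con 8 :* n :+ con 4 :* (con 8 :* n) := con 3 :* n :+ con 37 :* n) refl n′)
                (solve 2 (λ n s → s :* con 288 :+ con 33 :* n :+ con 4 :* n := con 288 :* s :+ con 37 :* n) refl n′ s)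
      (^-cancelˡ-≤ _ _ (begin
        2 ^ (8 * n′ + 4 * (8 * n′))
          ≡⟨ ^-distribˡ-+-* 2 (8 * n′) (4 * (8 * n′)) ⟩
        2 ^ (8 * n′) * 2 ^ (4 * (8 * n′))
          ≡⟨ cong (2 ^ (8 * n′) *_) (^-*-assoc 2 4 (8 * n′)) ⟨
        2 ^ (8 * n′) * 16 ^ (8 * n′)
          ≤⟨ volume ⟩
        (2 ^ s) ^ 288 * 17 ^ (8 * n′) * 16 ^ n′
          ≡⟨ cong₂ (λ a b → a * b * 16 ^ n′) (^-*-assoc 2 s 288) (sym (^-*-assoc 17 8 n′)) ⟩
        2 ^ (s * 288) * (17 ^ 8) ^ n′ * 16 ^ n′
          ≤⟨ *-monoˡ-≤ (16 ^ n′) (*-monoʳ-≤ (2 ^ (s * 288)) (^-monoˡ-≤ n′ (≤ᵇ⇒≤ (17 ^ 8) (2 ^ 33) _))) ⟩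
        2 ^ (s * 288) * (2 ^ 33) ^ n′ * 16 ^ n′
          ≡⟨ cong₂ (λ a b → 2 ^ (s * 288) * a * b) (^-*-assoc 2 33 n′) (^-*-assoc 2 4 n′) ⟩
        2 ^ (s * 288) * 2 ^ (33 * n′) * 2 ^ (4 * n′)
          ≡⟨ cong (_* 2 ^ (4 * n′)) (^-distribˡ-+-* 2 (s * 288) (33 * n′)) ⟨
        2 ^ (s * 288 + 33 * n′) * 2 ^ (4 * n′)
          ≡⟨ ^-distribˡ-+-* 2 (s * 288 + 33 * n′) (4 * n′) ⟨
        2 ^ (s * 288 + 33 * n′ + 4 * n′) ∎)))
    where open ≤-Reasoning

  m≤3168s : ∀ m n′ r s → m ≡ 2 + (r + n′ * 16) → r < 16 → 18 ≤ m → 3 * n′ ≤ 288 * s → m ≤ 3168 * s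
  m≤3168s m zero    r s m≡ r<16 18≤m _ =
    ⊥-elim (<⇒≱ (subst (_< 18) (sym (trans m≡ (cong (2 +_) (+-identityʳ r)))) (s≤s (s≤s r<16))) 18≤m)
  m≤3168s m (suc k) r s m≡ r<16 18≤m 3n′≤288s = begin
    m                       ≡⟨ m≡ ⟩
    2 + (r + suc k * 16)    ≤⟨ +-monoʳ-≤ 2 (+-monoˡ-≤ (suc k * 16) (≤-pred r<16)) ⟩
    2 + (15 + suc k * 16)   ≡⟨ solve 1 (λ k → con 2 :+ (con 15 :+ (con 1 :+ k) :* con 16) := con 33 :+ k :* con 16) refl k ⟩
    33 + k * 16             ≤⟨ +-monoʳ-≤ 33 (*-monoʳ-≤ k (≤ᵇ⇒≤ 16 33 _)) ⟩
    suc k * 33              ≡⟨ *-comm (suc k) 33 ⟩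
    33 * suc k              ≤⟨ *-monoʳ-≤ 33 k<96s ⟩
    33 * (96 * s)           ≡⟨ *-assoc 33 96 s ⟨
    3168 * s                ∎
    where
    open ≤-Reasoning
    k<96s : suc k ≤ 96 * s
    k<96s = *-cancelˡ-≤ 3 (subst (3 * suc k ≤_) (*-assoc 3 96 s) 3n′≤288s)

open import Data.Nat using (ℕ; _≤_; _*_; _∸_; _^_; z≤n; s≤s)
open import Data.Nat.DivMod using (_/_; _%_; m≡m%n+[m/n]*n; m%n<n)
import Data.Nat.Properties as ℕ
open import Data.Nat.Solver using (module +-*-Solver)
open Averaging using (Separates; separates-from; module Decoding)
open HammingBalls using (code-size)
open SwapGadget using (hardPattern; encode; query; probe; probe-window; length-hardPattern)
open Arithmetic using (volume⇒3n′≤288s; m≤3168s)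

module _ {s : ℕ} (A : OnlineAlg s) {n′ r : ℕ} (solves : SolvesSwapMatching (hardPattern (8 * n′) r) A) where

  open Linearity A

  probe-separates : ∀ (x : Vec Bool (8 * n′)) j → Separates (lookup x j) (outProb A (probe x j r) true true)
  probe-separates x j =
    separates-from (lookup x j) (outProb-complement (probe x j r) true) (proj₁ answers) (proj₂ answers)
      (proj₂ (probe-window x j r))
    where
    answers = solves (probe x j r) true (proj₁ (probe-window x j r))

  open Decoding (λ x → stateDist A (encode x)) (λ x → stateDist-isDistribution (encode x))
    (λ j → emissionAfter (query (toℕ j) r) true true) (λ j → emissionAfter-nonNeg (query (toℕ j) r) true true)
    (λ j → emissionAfter-≤1 (query (toℕ j) r) true)
    (λ x j → subst (Separates (lookup x j)) (outProb-++ (encode x) (query (toℕ j) r) true true) (probe-separates x j))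

  volume-bound : 2 ^ (8 * n′) * 16 ^ (8 * n′) ≤ (2 ^ s) ^ 288 * 17 ^ (8 * n′) * 16 ^ n′
  volume-bound = code-size (8 * n′) 288 n′ (λ x → proj₁ (decode-close x)) decode
    (λ x → ℕ.*-cancelˡ-≤ 8 (subst (_≤ 8 * n′) (ℕ.*-comm (hamming x (decode (proj₁ (decode-close x)))) 8)
                                  (proj₂ (decode-close x))))

blockCount : ℕ → ℕ
blockCount m = (m ∸ 2) / 16

padding : ℕ → ℕ
padding m = (m ∸ 2) % 16

m≡2+padding+16blockCount : ∀ m → 2 ≤ m → m ≡ 2 ℕ.+ (padding m ℕ.+ blockCount m * 16)
m≡2+padding+16blockCount m 2≤m = trans (sym (ℕ.m+[n∸m]≡n 2≤m)) (cong (2 ℕ.+_) (m≡m%n+[m/n]*n (m ∸ 2) 16))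

length-hardPattern-blocks : ∀ m → 2 ≤ m → length (hardPattern (8 * blockCount m) (padding m)) ≡ m
length-hardPattern-blocks m 2≤m = trans (length-hardPattern (8 * blockCount m) (padding m))
  (trans (solve 2 (λ n r → con 2 :+ (r :+ con 2 :* (con 8 :* n)) := con 2 :+ (r :+ n :* con 16))
                  refl (blockCount m) (padding m))
         (sym (m≡2+padding+16blockCount m 2≤m)))
  where open +-*-Solver

mainTheorem13 : Σ ℕ λ c → Σ ℕ λ m₀ → ∀ (m : ℕ) → m₀ ≤ m →
    Σ (List Bool) λ P → (length P ≡ m) ×
    (∀ (s : ℕ) (A : OnlineAlg s) → SolvesSwapMatching P A → m ≤ c * s)
mainTheorem13 = 3168 , 18 , λ m 18≤m →
  hardPattern (8 * blockCount m) (padding m) , length-hardPattern-blocks m (2≤ 18≤m) ,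
  λ s A solves → m≤3168s m (blockCount m) (padding m) s (m≡2+padding+16blockCount m (2≤ 18≤m))
    (m%n<n (m ∸ 2) 16) 18≤m (volume⇒3n′≤288s (blockCount m) s (volume-bound A {blockCount m} {padding m} solves))
  where
  2≤ : ∀ {m} → 18 ≤ m → 2 ≤ m
  2≤ = ℕ.≤-trans (s≤s (s≤s z≤n))
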